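{- Let $r\le s<n$. A set $F\subseteq[n]$ is a flat of the panhandle matroid $\mathrm{Pan}_{r,s,n}$ of rank less than $r$ if and only if either (1) $F\subseteq[s]$ and $|F|\le r-1$, or (2) $F=[s+1,n]\cup A$ for some $A\subseteq[s]$ with $|A|\le r-2$.
   Context: $\mathrm{Pan}_{r,s,n}$ is the rank-$r$ matroid on $[n]$ whose bases are the $r$-subsets $B\subseteq[n]$ with $|B\cap[s]|\ge r-1$. A flat is a set $F$ with $\mathrm{rank}(G)>\mathrm{rank}(F)$ for all $G\supsetneq F$. $[a,b]=\{a,\dots,b\}$. -}

module Defs where

open import Data.Nat using (ℕ; zero; suc; _∸_; _⊔_; _<_; _≡ᵇ_; _≤ᵇ_; _<ᵇ_)
open import Data.Bool using (Bool; true; false; _∧_; if_then_else_)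
open import Data.Fin using (Fin; toℕ)
open import Data.Fin.Subset using (Subset; inside; outside; _∩_; _⊂_; ∣_∣)
open import Data.Vec using (_∷_; []; tabulate)
open import Data.List using (List; _∷_; []; concatMap; foldr)

-- Ground set [n] = {1,…,n} is modelled by Fin n, with paper element k ↦ Fin index k-1.
-- [s] = {1,…,s} corresponds to the indices i with toℕ i < s.
initSeg : (n s : ℕ) → Subset n
initSeg n s = tabulate (λ i → toℕ i <ᵇ s)

allSubsets : (n : ℕ) → List (Subset n)
allSubsets zero = [] ∷ []
allSubsets (suc n) = concatMap (λ p → (inside ∷ p) ∷ (outside ∷ p) ∷ []) (allSubsets n)

isBasis : (r s : ℕ) {n : ℕ} → Subset n → Bool
isBasis r s {n} B = (∣ B ∣ ≡ᵇ r) ∧ (r ∸ 1 ≤ᵇ ∣ B ∩ initSeg n s ∣)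

panRank : (r s : ℕ) {n : ℕ} → Subset n → ℕ
panRank r s {n} X =
  foldr (λ B acc → if isBasis r s B then ∣ X ∩ B ∣ ⊔ acc else acc) 0 (allSubsets n)

IsFlat : (r s : ℕ) {n : ℕ} → Subset n → Set
IsFlat r s {n} F = (G : Subset n) → F ⊂ G → panRank r s F < panRank r s G

-- Pan_{r,s,n} is the rank-r truncation of the direct sum of the free matroid on [s] with the
-- rank-one uniform matroid on the handle [s+1,n], so its rank is
-- rank X = min(r, |X ∩ [s]| + min(1, |X ∖ [s]|)).  Below rank r, a set is a flat exactly when
-- adding any point raises the untruncated rank by one.  Points of [s] always do; a point of the
-- handle does so only when X misses the handle.  Hence a flat of rank < r either misses the
-- handle (case 1) or contains all of it (case 2).  The hypothesis s < n is only used as s ≤ n.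
module Submission where

open import Defs
open import Data.Nat using (ℕ; zero; suc; _+_; _∸_; _⊓_; _⊔_; _≤_; _<_; z≤n; s≤s; _≤?_)
open import Data.Nat.Properties
open import Data.Bool using (Bool; true; false; T; if_then_else_)
open import Data.Bool.Properties using (T-∧)
open import Data.Unit using (tt)
open import Data.Fin using (Fin)
open import Data.Fin.Subset
open import Data.Fin.Subset.Properties
open import Data.Vec using (_∷_; []; here; there)
open import Data.List using (List; _∷_; []; foldr)
import Data.List.Membership.Propositional as List
open import Data.List.Membership.Propositional.Properties using (∈-concatMap⁺)
import Data.List.Relation.Unary.Any as Any
open import Data.Product using (_×_; _,_; proj₁; proj₂; ∃-syntax)
open import Data.Sum using (_⊎_; inj₁; inj₂)
open import Function using (_∘_)
open import Function.Bundles using (_⇔_; mk⇔; Equivalence)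
open import Function.Construct.Composition using (_⇔-∘_)
open import Data.Product.Function.NonDependent.Propositional using (_×-⇔_)
open import Relation.Nullary using (yes; no; contradiction)
open import Relation.Binary.PropositionalEquality

m+n∸1≤m⇔n≤1 : ∀ m n → m + n ∸ 1 ≤ m ⇔ n ≤ 1
m+n∸1≤m⇔n≤1 m n = mk⇔ (to n) from
  where
  to : ∀ n → m + n ∸ 1 ≤ m → n ≤ 1
  to zero          _  = z≤n
  to (suc zero)    _  = ≤-refl
  to (suc (suc n)) le = contradiction (subst (λ k → k ∸ 1 ≤ m) (+-suc m (suc n)) le) (m+1+n≰m m)
  from : n ≤ 1 → m + n ∸ 1 ≤ m
  from n≤1 = m≤n+o⇒m∸n≤o (m + n) 1 (subst (m + n ≤_) (+-comm m 1) (+-monoʳ-≤ m n≤1))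

m⊓n<m⇒n<m : ∀ m n → m ⊓ n < m → n < m
m⊓n<m⇒n<m m n m⊓n<m with m ≤? n
... | yes m≤n = contradiction (subst (_< m) (m≤n⇒m⊓n≡m m≤n) m⊓n<m) (<-irrefl refl)
... | no  m≰n = ≰⇒> m≰n

n<m⇒m⊓n<m⊓1+n : ∀ {m n} → n < m → m ⊓ n < m ⊓ suc n
n<m⇒m⊓n<m⊓1+n {m} {n} n<m =
  subst₂ _<_ (sym (m≥n⇒m⊓n≡n (<⇒≤ n<m))) (sym (m≥n⇒m⊓n≡n n<m)) (n<1+n n)

m⊓[n+o]≤m⊓n+[m∸m⊓n]⊓o : ∀ m n o → m ⊓ (n + o) ≤ m ⊓ n + (m ∸ m ⊓ n) ⊓ o
m⊓[n+o]≤m⊓n+[m∸m⊓n]⊓o zero    n       o = z≤n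
m⊓[n+o]≤m⊓n+[m∸m⊓n]⊓o (suc m) zero    o = ≤-refl
m⊓[n+o]≤m⊓n+[m∸m⊓n]⊓o (suc m) (suc n) o = s≤s (m⊓[n+o]≤m⊓n+[m∸m⊓n]⊓o m n o)

private variable
  n : ℕ
  p q : Subset n
  x : Fin n

∣p∣≡∣p∩q∣+∣p∩∁q∣ : (p q : Subset n) → ∣ p ∣ ≡ ∣ p ∩ q ∣ + ∣ p ∩ ∁ q ∣
∣p∣≡∣p∩q∣+∣p∩∁q∣ []          []          = refl
∣p∣≡∣p∩q∣+∣p∩∁q∣ (true  ∷ p) (true  ∷ q) = cong suc (∣p∣≡∣p∩q∣+∣p∩∁q∣ p q)
∣p∣≡∣p∩q∣+∣p∩∁q∣ (true  ∷ p) (false ∷ q) =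
  trans (cong suc (∣p∣≡∣p∩q∣+∣p∩∁q∣ p q)) (sym (+-suc _ _))
∣p∣≡∣p∩q∣+∣p∩∁q∣ (false ∷ p) (_     ∷ q) = ∣p∣≡∣p∩q∣+∣p∩∁q∣ p q

∣p∪q∣≡∣p∣+∣q∣ : (p q : Subset n) → Empty (p ∩ q) → ∣ p ∪ q ∣ ≡ ∣ p ∣ + ∣ q ∣
∣p∪q∣≡∣p∣+∣q∣ []          []          _        = refl
∣p∪q∣≡∣p∣+∣q∣ (true  ∷ p) (true  ∷ q) disjoint = contradiction (_ , here) disjoint
∣p∪q∣≡∣p∣+∣q∣ (true  ∷ p) (false ∷ q) disjoint =
  cong suc (∣p∪q∣≡∣p∣+∣q∣ p q (λ (y , y∈) → disjoint (_ , there y∈)))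
∣p∪q∣≡∣p∣+∣q∣ (false ∷ p) (true  ∷ q) disjoint =
  trans (cong suc (∣p∪q∣≡∣p∣+∣q∣ p q (λ (y , y∈) → disjoint (_ , there y∈)))) (sym (+-suc _ _))
∣p∪q∣≡∣p∣+∣q∣ (false ∷ p) (false ∷ q) disjoint =
  ∣p∪q∣≡∣p∣+∣q∣ p q (λ (y , y∈) → disjoint (_ , there y∈))

∃⊆-of-size : (p : Subset n) {k : ℕ} → k ≤ ∣ p ∣ → ∃[ q ] (q ⊆ p × ∣ q ∣ ≡ k)
∃⊆-of-size []          {zero}  _         = [] , (λ ()) , refl
∃⊆-of-size {suc n} (true ∷ p) {zero} _ = ⊥ , ⊥⊆ , ∣⊥∣≡0 (suc n)
∃⊆-of-size (true  ∷ p) {suc k} (s≤s k≤p) with ∃⊆-of-size p k≤p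
... | q , q⊆p , ∣q∣≡k = inside ∷ q , in⊆in q⊆p , cong suc ∣q∣≡k
∃⊆-of-size (false ∷ p) k≤p with ∃⊆-of-size p k≤p
... | q , q⊆p , ∣q∣≡k = outside ∷ q , out⊆ q⊆p , ∣q∣≡k

x∈p⇒0<∣p∣ : x ∈ p → 0 < ∣ p ∣
x∈p⇒0<∣p∣ {n} {p = p} x∈p = subst (_< ∣ p ∣) (∣⊥∣≡0 n) (p⊂q⇒∣p∣<∣q∣ (⊥⊆ , _ , x∈p , ∉⊥))

p⊆q⇒∣p∩∁q∣≡0 : p ⊆ q → ∣ p ∩ ∁ q ∣ ≡ 0
p⊆q⇒∣p∩∁q∣≡0 {n} {p} {q} p⊆q = n≤0⇒n≡0 (subst (∣ p ∩ ∁ q ∣ ≤_) (∣⊥∣≡0 n) (p⊆q⇒∣p∣≤∣q∣ p∩∁q⊆⊥))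
  where
  p∩∁q⊆⊥ : p ∩ ∁ q ⊆ ⊥
  p∩∁q⊆⊥ y∈ = let (y∈p , y∈∁q) = x∈p∩q⁻ p (∁ q) y∈ in contradiction (p⊆q y∈p) (x∈∁p⇒x∉p y∈∁q)

∣p∩∁q∣≡0⇒p⊆q : ∣ p ∩ ∁ q ∣ ≡ 0 → p ⊆ q
∣p∩∁q∣≡0⇒p⊆q {q = q} ∣p∩∁q∣≡0 {y} y∈p with y ∈? q
... | yes y∈q = y∈q
... | no  y∉q = contradiction (subst (0 <_) ∣p∩∁q∣≡0 (x∈p⇒0<∣p∣ (x∈p∩q⁺ (y∈p , x∉p⇒x∈∁p y∉q)))) (<-irrefl refl)

p⊆q⇒∣p∩q∣≡∣p∣ : p ⊆ q → ∣ p ∩ q ∣ ≡ ∣ p ∣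
p⊆q⇒∣p∩q∣≡∣p∣ {p = p} {q} p⊆q = sym (begin
  ∣ p ∣                       ≡⟨ ∣p∣≡∣p∩q∣+∣p∩∁q∣ p q ⟩
  ∣ p ∩ q ∣ + ∣ p ∩ ∁ q ∣     ≡⟨ cong (∣ p ∩ q ∣ +_) (p⊆q⇒∣p∩∁q∣≡0 p⊆q) ⟩
  ∣ p ∩ q ∣ + 0               ≡⟨ +-identityʳ _ ⟩
  ∣ p ∩ q ∣                   ∎)
  where open ≡-Reasoning

p⊆q⇒p∩r⊆q∩r : ∀ r → p ⊆ q → p ∩ r ⊆ q ∩ r
p⊆q⇒p∩r⊆q∩r {p = p} r p⊆q y∈ = let (y∈p , y∈r) = x∈p∩q⁻ p r y∈ in x∈p∩q⁺ (p⊆q y∈p , y∈r)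

∁q⊆p⇒p≡∁q∪[p∩q] : ∁ q ⊆ p → p ≡ ∁ q ∪ (p ∩ q)
∁q⊆p⇒p≡∁q∪[p∩q] {q = q} {p} ∁q⊆p = ⊆-antisym split join
  where
  split : p ⊆ ∁ q ∪ (p ∩ q)
  split {y} y∈p with y ∈? q
  ... | yes y∈q = x∈p∪q⁺ (inj₂ (x∈p∩q⁺ (y∈p , y∈q)))
  ... | no  y∉q = x∈p∪q⁺ (inj₁ (x∉p⇒x∈∁p y∉q))
  join : ∁ q ∪ (p ∩ q) ⊆ p
  join y∈ with x∈p∪q⁻ (∁ q) (p ∩ q) y∈
  ... | inj₁ y∈∁q = ∁q⊆p y∈∁q
  ... | inj₂ y∈p∩q = proj₁ (x∈p∩q⁻ p q y∈p∩q)

q⊆r⇒[p∪q]∩∁r⊆p∩∁r : ∀ {p q r : Subset n} → q ⊆ r → (p ∪ q) ∩ ∁ r ⊆ p ∩ ∁ r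
q⊆r⇒[p∪q]∩∁r⊆p∩∁r {p = p} {q = q} {r = r} q⊆r y∈ with x∈p∩q⁻ (p ∪ q) (∁ r) y∈
... | y∈p∪q , y∈∁r with x∈p∪q⁻ p q y∈p∪q
...   | inj₁ y∈p = x∈p∩q⁺ (y∈p , y∈∁r)
...   | inj₂ y∈q = contradiction y∈∁r (x∈p⇒x∉∁p (q⊆r y∈q))

p⊂p∪⁅x⁆ : x ∉ p → p ⊂ p ∪ ⁅ x ⁆
p⊂p∪⁅x⁆ {x = x} x∉p = p⊆p∪q ⁅ x ⁆ , x , x∈p∪q⁺ (inj₂ (x∈⁅x⁆ x)) , x∉p

p⊆q∧x∈q⇒p∪⁅x⁆⊆q : p ⊆ q → x ∈ q → p ∪ ⁅ x ⁆ ⊆ q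
p⊆q∧x∈q⇒p∪⁅x⁆⊆q {p = p} {q} {x} p⊆q x∈q y∈ with x∈p∪q⁻ p ⁅ x ⁆ y∈
... | inj₁ y∈p    = p⊆q y∈p
... | inj₂ y∈⁅x⁆ = subst (_∈ q) (sym (x∈⁅y⁆⇒x≡y x y∈⁅x⁆)) x∈q

⁅x⁆∩q≡⁅x⁆ : x ∈ q → ⁅ x ⁆ ∩ q ≡ ⁅ x ⁆
⁅x⁆∩q≡⁅x⁆ {x = x} {q} x∈q = ⊆-antisym (p∩q⊆p ⁅ x ⁆ q)
  (λ y∈⁅x⁆ → x∈p∩q⁺ (y∈⁅x⁆ , subst (_∈ q) (sym (x∈⁅y⁆⇒x≡y x y∈⁅x⁆)) x∈q))

⁅x⁆∩q≡⊥ : x ∉ q → ⁅ x ⁆ ∩ q ≡ ⊥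
⁅x⁆∩q≡⊥ {x = x} {q} x∉q = ⊆-antisym ⁅x⁆∩q⊆⊥ ⊥⊆
  where
  ⁅x⁆∩q⊆⊥ : ⁅ x ⁆ ∩ q ⊆ ⊥
  ⁅x⁆∩q⊆⊥ y∈ = let (y∈⁅x⁆ , y∈q) = x∈p∩q⁻ ⁅ x ⁆ q y∈ in
    contradiction (subst (_∈ q) (x∈⁅y⁆⇒x≡y x y∈⁅x⁆) y∈q) x∉q

∣p∪⁅x⁆∣≡1+∣p∣ : x ∉ p → ∣ p ∪ ⁅ x ⁆ ∣ ≡ suc ∣ p ∣
∣p∪⁅x⁆∣≡1+∣p∣ {x = x} {p} x∉p = begin
  ∣ p ∪ ⁅ x ⁆ ∣      ≡⟨ ∣p∪q∣≡∣p∣+∣q∣ p ⁅ x ⁆ disjoint ⟩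
  ∣ p ∣ + ∣ ⁅ x ⁆ ∣  ≡⟨ cong (∣ p ∣ +_) (∣⁅x⁆∣≡1 x) ⟩
  ∣ p ∣ + 1          ≡⟨ +-comm ∣ p ∣ 1 ⟩
  suc ∣ p ∣          ∎
  where
  open ≡-Reasoning
  disjoint : Empty (p ∩ ⁅ x ⁆)
  disjoint (y , y∈) = let (y∈p , y∈⁅x⁆) = x∈p∩q⁻ p ⁅ x ⁆ y∈ in
    x∉p (subst (_∈ p) (x∈⁅y⁆⇒x≡y x y∈⁅x⁆) y∈p)

∣[p∪⁅x⁆]∩q∣≡1+∣p∩q∣ : x ∉ p → x ∈ q → ∣ (p ∪ ⁅ x ⁆) ∩ q ∣ ≡ suc ∣ p ∩ q ∣
∣[p∪⁅x⁆]∩q∣≡1+∣p∩q∣ {x = x} {p} {q} x∉p x∈q = begin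
  ∣ (p ∪ ⁅ x ⁆) ∩ q ∣        ≡⟨ cong ∣_∣ (∩-distribʳ-∪ q p ⁅ x ⁆) ⟩
  ∣ p ∩ q ∪ ⁅ x ⁆ ∩ q ∣      ≡⟨ cong (λ t → ∣ p ∩ q ∪ t ∣) (⁅x⁆∩q≡⁅x⁆ x∈q) ⟩
  ∣ p ∩ q ∪ ⁅ x ⁆ ∣          ≡⟨ ∣p∪⁅x⁆∣≡1+∣p∣ (x∉p ∘ proj₁ ∘ x∈p∩q⁻ p q) ⟩
  suc ∣ p ∩ q ∣              ∎
  where open ≡-Reasoning

∣[p∪⁅x⁆]∩q∣≡∣p∩q∣ : x ∉ q → ∣ (p ∪ ⁅ x ⁆) ∩ q ∣ ≡ ∣ p ∩ q ∣
∣[p∪⁅x⁆]∩q∣≡∣p∩q∣ {x = x} {q} {p} x∉q = begin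
  ∣ (p ∪ ⁅ x ⁆) ∩ q ∣        ≡⟨ cong ∣_∣ (∩-distribʳ-∪ q p ⁅ x ⁆) ⟩
  ∣ p ∩ q ∪ ⁅ x ⁆ ∩ q ∣      ≡⟨ cong (λ t → ∣ p ∩ q ∪ t ∣) (⁅x⁆∩q≡⊥ x∉q) ⟩
  ∣ p ∩ q ∪ ⊥ ∣              ≡⟨ cong ∣_∣ (∪-identityʳ (p ∩ q)) ⟩
  ∣ p ∩ q ∣                  ∎
  where open ≡-Reasoning

module _ {A : Set} (P : A → Bool) (f : A → ℕ) where

  maxWhere : List A → ℕ
  maxWhere = foldr (λ a acc → if P a then f a ⊔ acc else acc) 0

  maxWhere-lub : ∀ {m} as → (∀ a → T (P a) → f a ≤ m) → maxWhere as ≤ m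
  maxWhere-lub []       _     = z≤n
  maxWhere-lub (a ∷ as) bound with P a in Pa
  ... | true  = ⊔-lub (bound a (subst T (sym Pa) tt)) (maxWhere-lub as bound)
  ... | false = maxWhere-lub as bound

  maxWhere-upper : ∀ {a} as → a List.∈ as → T (P a) → f a ≤ maxWhere as
  maxWhere-upper {a} (a ∷ as) (Any.here refl) Pa with P a
  ... | true = m≤m⊔n (f a) _
  maxWhere-upper (b ∷ as) (Any.there a∈as) Pa with P b
  ... | true  = ≤-trans (maxWhere-upper as a∈as Pa) (m≤n⊔m (f b) _)
  ... | false = maxWhere-upper as a∈as Pa

module TruncatedRank {n : ℕ} (r : ℕ) (S : Subset n) where

  private variable
    X Y F A : Subset n

  untruncatedRank : Subset n → ℕ
  untruncatedRank X = ∣ X ∩ S ∣ + 1 ⊓ ∣ X ∩ ∁ S ∣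

  rank : Subset n → ℕ
  rank X = r ⊓ untruncatedRank X

  rank-mono : X ⊆ Y → rank X ≤ rank Y
  rank-mono X⊆Y = ⊓-monoʳ-≤ r (+-mono-≤
    (p⊆q⇒∣p∣≤∣q∣ (p⊆q⇒p∩r⊆q∩r S X⊆Y))
    (⊓-monoʳ-≤ 1 (p⊆q⇒∣p∣≤∣q∣ (p⊆q⇒p∩r⊆q∩r (∁ S) X⊆Y))))

  untruncatedRank-insert-∈ : x ∉ X → x ∈ S → untruncatedRank (X ∪ ⁅ x ⁆) ≡ suc (untruncatedRank X)
  untruncatedRank-insert-∈ {X = X} x∉X x∈S = cong₂ (λ a c → a + 1 ⊓ c)
    (∣[p∪⁅x⁆]∩q∣≡1+∣p∩q∣ x∉X x∈S) (∣[p∪⁅x⁆]∩q∣≡∣p∩q∣ {p = X} (x∈p⇒x∉∁p x∈S))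

  untruncatedRank-insert-∉ : x ∉ X → x ∉ S → untruncatedRank (X ∪ ⁅ x ⁆) ≡ ∣ X ∩ S ∣ + 1
  untruncatedRank-insert-∉ {X = X} x∉X x∉S = cong₂ (λ a c → a + 1 ⊓ c)
    (∣[p∪⁅x⁆]∩q∣≡∣p∩q∣ {p = X} x∉S) (∣[p∪⁅x⁆]∩q∣≡1+∣p∩q∣ x∉X (x∉p⇒x∈∁p x∉S))

  Independent : Subset n → Set
  Independent I = ∣ I ∣ ≤ r × ∣ I ∩ ∁ S ∣ ≤ 1

  ∃-independent-⊆-of-rank : ∀ X → ∃[ I ] (I ⊆ X × Independent I × rank X ≤ ∣ I ∣)
  -- Greedily take r ⊓ ∣ X ∩ S ∣ points of X ∩ S, then a point of X ∖ S if r leaves room for it.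
  ∃-independent-⊆-of-rank X =
    combine (∃⊆-of-size (X ∩ S) (m⊓n≤n r a))
            (∃⊆-of-size (X ∩ ∁ S) (≤-trans (m⊓n≤n (r ∸ k) _) (m⊓n≤n 1 _)))
    where
    a = ∣ X ∩ S ∣
    k = r ⊓ a
    j = (r ∸ k) ⊓ (1 ⊓ ∣ X ∩ ∁ S ∣)
    combine : ∃[ Z₁ ] (Z₁ ⊆ X ∩ S × ∣ Z₁ ∣ ≡ k) → ∃[ Z₂ ] (Z₂ ⊆ X ∩ ∁ S × ∣ Z₂ ∣ ≡ j) →
              ∃[ I ] (I ⊆ X × Independent I × rank X ≤ ∣ I ∣)
    combine (Z₁ , Z₁⊆X∩S , ∣Z₁∣≡k) (Z₂ , Z₂⊆X∩∁S , ∣Z₂∣≡j) =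
      Z₂ ∪ Z₁ , I⊆X , (∣I∣≤r , ∣I∩∁S∣≤1) , rank≤∣I∣
      where
      Z₁⊆S : Z₁ ⊆ S
      Z₁⊆S = proj₂ ∘ x∈p∩q⁻ X S ∘ Z₁⊆X∩S
      I⊆X : Z₂ ∪ Z₁ ⊆ X
      I⊆X y∈ with x∈p∪q⁻ Z₂ Z₁ y∈
      ... | inj₁ y∈Z₂ = proj₁ (x∈p∩q⁻ X (∁ S) (Z₂⊆X∩∁S y∈Z₂))
      ... | inj₂ y∈Z₁ = proj₁ (x∈p∩q⁻ X S (Z₁⊆X∩S y∈Z₁))
      ∣I∣≡j+k : ∣ Z₂ ∪ Z₁ ∣ ≡ j + k
      ∣I∣≡j+k = trans
        (∣p∪q∣≡∣p∣+∣q∣ Z₂ Z₁ λ (y , y∈) → let (y∈Z₂ , y∈Z₁) = x∈p∩q⁻ Z₂ Z₁ y∈ in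
          x∈p⇒x∉∁p (Z₁⊆S y∈Z₁) (proj₂ (x∈p∩q⁻ X (∁ S) (Z₂⊆X∩∁S y∈Z₂))))
        (cong₂ _+_ ∣Z₂∣≡j ∣Z₁∣≡k)
      ∣I∣≤r : ∣ Z₂ ∪ Z₁ ∣ ≤ r
      ∣I∣≤r = begin
        ∣ Z₂ ∪ Z₁ ∣  ≡⟨ trans ∣I∣≡j+k (+-comm j k) ⟩
        k + j        ≤⟨ +-monoʳ-≤ k (m⊓n≤m (r ∸ k) _) ⟩
        k + (r ∸ k)  ≡⟨ m+[n∸m]≡n (m⊓n≤m r a) ⟩
        r            ∎
        where open ≤-Reasoning
      ∣I∩∁S∣≤1 : ∣ (Z₂ ∪ Z₁) ∩ ∁ S ∣ ≤ 1
      ∣I∩∁S∣≤1 = begin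
        ∣ (Z₂ ∪ Z₁) ∩ ∁ S ∣  ≤⟨ p⊆q⇒∣p∣≤∣q∣ (q⊆r⇒[p∪q]∩∁r⊆p∩∁r {p = Z₂} Z₁⊆S) ⟩
        ∣ Z₂ ∩ ∁ S ∣         ≤⟨ ∣p∩q∣≤∣p∣ Z₂ (∁ S) ⟩
        ∣ Z₂ ∣               ≡⟨ ∣Z₂∣≡j ⟩
        j                    ≤⟨ m⊓n≤n (r ∸ k) _ ⟩
        1 ⊓ ∣ X ∩ ∁ S ∣      ≤⟨ m⊓n≤m 1 _ ⟩
        1                    ∎
        where open ≤-Reasoning
      rank≤∣I∣ : rank X ≤ ∣ Z₂ ∪ Z₁ ∣
      rank≤∣I∣ = begin
        rank X   ≤⟨ m⊓[n+o]≤m⊓n+[m∸m⊓n]⊓o r a _ ⟩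
        k + j    ≡⟨ +-comm k j ⟩
        j + k    ≡⟨ sym ∣I∣≡j+k ⟩
        ∣ Z₂ ∪ Z₁ ∣ ∎
        where open ≤-Reasoning

  Closed : Subset n → Set
  Closed F = ∀ x → x ∉ F → rank F < rank (F ∪ ⁅ x ⁆)

  LowRankFlatShape : Subset n → Set
  LowRankFlatShape F =
    (F ⊆ S × ∣ F ∣ + 1 ≤ r) ⊎ (∃[ A ] (A ⊆ S × ∣ A ∣ + 2 ≤ r × F ≡ ∁ S ∪ A))

  closed-if-insertions-grow : untruncatedRank F < r →
    (∀ {x} → x ∉ F → untruncatedRank (F ∪ ⁅ x ⁆) ≡ suc (untruncatedRank F)) →
    Closed F × rank F < r
  closed-if-insertions-grow {F} u<r grow =
    (λ x x∉F → subst (λ k → rank F < r ⊓ k) (sym (grow x∉F)) (n<m⇒m⊓n<m⊓1+n u<r)) ,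
    m<n⇒o⊓m<n r u<r

  ⊆S⇒closed : F ⊆ S → ∣ F ∣ + 1 ≤ r → Closed F × rank F < r
  ⊆S⇒closed {F} F⊆S ∣F∣+1≤r = closed-if-insertions-grow u<r grow
    where
    u≡∣F∣ : untruncatedRank F ≡ ∣ F ∣
    u≡∣F∣ = begin
      ∣ F ∩ S ∣ + 1 ⊓ ∣ F ∩ ∁ S ∣  ≡⟨ cong (λ c → ∣ F ∩ S ∣ + 1 ⊓ c) (p⊆q⇒∣p∩∁q∣≡0 F⊆S) ⟩
      ∣ F ∩ S ∣ + 0                ≡⟨ +-identityʳ _ ⟩
      ∣ F ∩ S ∣                    ≡⟨ p⊆q⇒∣p∩q∣≡∣p∣ F⊆S ⟩
      ∣ F ∣                        ∎
      where open ≡-Reasoning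
    u<r : untruncatedRank F < r
    u<r = subst (_< r) (sym u≡∣F∣) (subst (_≤ r) (+-comm ∣ F ∣ 1) ∣F∣+1≤r)
    grow : x ∉ F → untruncatedRank (F ∪ ⁅ x ⁆) ≡ suc (untruncatedRank F)
    grow {x} x∉F with x ∈? S
    ... | yes x∈S = untruncatedRank-insert-∈ x∉F x∈S
    ... | no  x∉S = begin
      untruncatedRank (F ∪ ⁅ x ⁆)  ≡⟨ untruncatedRank-insert-∉ x∉F x∉S ⟩
      ∣ F ∩ S ∣ + 1                ≡⟨ cong (_+ 1) (p⊆q⇒∣p∩q∣≡∣p∣ F⊆S) ⟩
      ∣ F ∣ + 1                    ≡⟨ +-comm ∣ F ∣ 1 ⟩
      suc ∣ F ∣                    ≡⟨ cong suc (sym u≡∣F∣) ⟩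
      suc (untruncatedRank F)      ∎
      where open ≡-Reasoning

  ∁S∪A⇒closed : A ⊆ S → ∣ A ∣ + 2 ≤ r → Closed (∁ S ∪ A) × rank (∁ S ∪ A) < r
  ∁S∪A⇒closed {A} A⊆S ∣A∣+2≤r = closed-if-insertions-grow u<r grow
    where
    F∩S⊆A : (∁ S ∪ A) ∩ S ⊆ A
    F∩S⊆A y∈ with x∈p∩q⁻ (∁ S ∪ A) S y∈
    ... | y∈F , y∈S with x∈p∪q⁻ (∁ S) A y∈F
    ...   | inj₁ y∈∁S = contradiction y∈S (x∈∁p⇒x∉p y∈∁S)
    ...   | inj₂ y∈A  = y∈A
    u<r : untruncatedRank (∁ S ∪ A) < r
    u<r = ≤-trans (s≤s (+-mono-≤ (p⊆q⇒∣p∣≤∣q∣ F∩S⊆A) (m⊓n≤m 1 _)))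
                  (subst (_≤ r) (+-suc ∣ A ∣ 1) ∣A∣+2≤r)
    grow : x ∉ ∁ S ∪ A → untruncatedRank ((∁ S ∪ A) ∪ ⁅ x ⁆) ≡ suc (untruncatedRank (∁ S ∪ A))
    grow x∉F = untruncatedRank-insert-∈ x∉F (x∉∁p⇒x∈p (x∉F ∘ x∈p∪q⁺ ∘ inj₁))

  closed⇒lowRankFlatShape : Closed F → rank F < r → LowRankFlatShape F
  closed⇒lowRankFlatShape {F} closed rank<r = byHandleCount ∣ F ∩ ∁ S ∣ refl
    where
    a = ∣ F ∩ S ∣
    u<r : untruncatedRank F < r
    u<r = m⊓n<m⇒n<m r _ rank<r
    byHandleCount : ∀ c → ∣ F ∩ ∁ S ∣ ≡ c → LowRankFlatShape F
    byHandleCount zero c≡0 = inj₁ (∣p∩∁q∣≡0⇒p⊆q c≡0 , subst (_≤ r) (+-comm 1 ∣ F ∣) ∣F∣<r)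
      where
      ∣F∣≡u : ∣ F ∣ ≡ untruncatedRank F
      ∣F∣≡u = begin
        ∣ F ∣                          ≡⟨ ∣p∣≡∣p∩q∣+∣p∩∁q∣ F S ⟩
        a + ∣ F ∩ ∁ S ∣                ≡⟨ cong (a +_) c≡0 ⟩
        a + 0                          ≡⟨ cong (λ c → a + 1 ⊓ c) (sym c≡0) ⟩
        untruncatedRank F              ∎
        where open ≡-Reasoning
      ∣F∣<r : ∣ F ∣ < r
      ∣F∣<r = subst (_< r) (sym ∣F∣≡u) u<r
    byHandleCount (suc c) c≡1+c =
      inj₂ (F ∩ S , p∩q⊆q F S , subst (_≤ r) (sym (+-suc a 1)) a+1<r , ∁q⊆p⇒p≡∁q∪[p∩q] ∁S⊆F)
      where
      u≡a+1 : untruncatedRank F ≡ a + 1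
      u≡a+1 = cong (λ c → a + 1 ⊓ c) c≡1+c
      a+1<r : a + 1 < r
      a+1<r = subst (_< r) u≡a+1 u<r
      ∁S⊆F : ∁ S ⊆ F
      ∁S⊆F {y} y∈∁S with y ∈? F
      ... | yes y∈F = y∈F
      ... | no  y∉F = contradiction (closed y y∉F) (<-irrefl (cong (r ⊓_)
                        (trans u≡a+1 (sym (untruncatedRank-insert-∉ y∉F (x∈∁p⇒x∉p y∈∁S))))))

  closed×rank<r⇔lowRankFlatShape : (Closed F × rank F < r) ⇔ LowRankFlatShape F
  closed×rank<r⇔lowRankFlatShape = mk⇔
    (λ (closed , rank<r) → closed⇒lowRankFlatShape closed rank<r)
    λ { (inj₁ (F⊆S , ∣F∣+1≤r)) → ⊆S⇒closed F⊆S ∣F∣+1≤r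
      ; (inj₂ (A , A⊆S , ∣A∣+2≤r , refl)) → ∁S∪A⇒closed A⊆S ∣A∣+2≤r }

∣initSeg∣ : ∀ n s → s ≤ n → ∣ initSeg n s ∣ ≡ s
∣initSeg∣ zero    zero    _         = refl
∣initSeg∣ (suc n) zero    _         = ∣initSeg∣ n zero z≤n
∣initSeg∣ (suc n) (suc s) (s≤s s≤n) = cong suc (∣initSeg∣ n s s≤n)

∈-allSubsets : (p : Subset n) → p List.∈ allSubsets n
∈-allSubsets []          = Any.here refl
∈-allSubsets (true  ∷ p) = ∈-concatMap⁺ _ (Any.map (λ { refl → Any.here refl }) (∈-allSubsets p))
∈-allSubsets (false ∷ p) = ∈-concatMap⁺ _ (Any.map (λ { refl → Any.there (Any.here refl) }) (∈-allSubsets p))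

module Panhandle (r s n : ℕ) (r≤s : r ≤ s) (s≤n : s ≤ n) where

  open TruncatedRank r (initSeg n s)

  private
    S : Subset n
    S = initSeg n s

  T-isBasis⇔ : ∀ B → T (isBasis r s B) ⇔ (∣ B ∣ ≡ r × ∣ B ∩ ∁ S ∣ ≤ 1)
  T-isBasis⇔ B = mk⇔
    (λ t → let (∣B∣≡ᵇr , r∸1≤ᵇa) = Equivalence.to T-∧ t
               ∣B∣≡r = ≡ᵇ⇒≡ _ _ ∣B∣≡ᵇr
           in ∣B∣≡r , Equivalence.to (r∸1≤a⇔c≤1 ∣B∣≡r) (≤ᵇ⇒≤ _ _ r∸1≤ᵇa))
    (λ (∣B∣≡r , c≤1) →
      Equivalence.from T-∧ (≡⇒≡ᵇ _ _ ∣B∣≡r , ≤⇒≤ᵇ (Equivalence.from (r∸1≤a⇔c≤1 ∣B∣≡r) c≤1)))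
    where
    r∸1≤a⇔c≤1 : ∣ B ∣ ≡ r → (r ∸ 1 ≤ ∣ B ∩ S ∣) ⇔ (∣ B ∩ ∁ S ∣ ≤ 1)
    r∸1≤a⇔c≤1 ∣B∣≡r = subst (λ m → (m ∸ 1 ≤ ∣ B ∩ S ∣) ⇔ (∣ B ∩ ∁ S ∣ ≤ 1))
      (trans (sym (∣p∣≡∣p∩q∣+∣p∩∁q∣ B S)) ∣B∣≡r) (m+n∸1≤m⇔n≤1 ∣ B ∩ S ∣ ∣ B ∩ ∁ S ∣)

  ∣X∩B∣≤rank : ∀ X {B} → T (isBasis r s B) → ∣ X ∩ B ∣ ≤ rank X
  ∣X∩B∣≤rank X {B} basis = ⊓-glb (≤-trans (∣p∩q∣≤∣q∣ X B) (≤-reflexive ∣B∣≡r)) (begin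
    ∣ X ∩ B ∣                            ≡⟨ ∣p∣≡∣p∩q∣+∣p∩∁q∣ (X ∩ B) S ⟩
    ∣ (X ∩ B) ∩ S ∣ + ∣ (X ∩ B) ∩ ∁ S ∣  ≤⟨ +-mono-≤ in-S (⊓-glb out-S≤1 out-S) ⟩
    untruncatedRank X                    ∎)
    where
    open ≤-Reasoning
    ∣B∣≡r = proj₁ (Equivalence.to (T-isBasis⇔ B) basis)
    in-S : ∣ (X ∩ B) ∩ S ∣ ≤ ∣ X ∩ S ∣
    in-S = p⊆q⇒∣p∣≤∣q∣ (p⊆q⇒p∩r⊆q∩r S (p∩q⊆p X B))
    out-S : ∣ (X ∩ B) ∩ ∁ S ∣ ≤ ∣ X ∩ ∁ S ∣
    out-S = p⊆q⇒∣p∣≤∣q∣ (p⊆q⇒p∩r⊆q∩r (∁ S) (p∩q⊆p X B))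
    out-S≤1 : ∣ (X ∩ B) ∩ ∁ S ∣ ≤ 1
    out-S≤1 = ≤-trans (p⊆q⇒∣p∣≤∣q∣ (p⊆q⇒p∩r⊆q∩r (∁ S) (p∩q⊆q X B)))
                      (proj₂ (Equivalence.to (T-isBasis⇔ B) basis))

  r∸∣I∣≤∣S∩∁I∣ : ∀ I → r ∸ ∣ I ∣ ≤ ∣ S ∩ ∁ I ∣
  r∸∣I∣≤∣S∩∁I∣ I = m≤n+o⇒m∸n≤o r ∣ I ∣ (begin
    r                          ≤⟨ r≤s ⟩
    s                          ≡⟨ sym (∣initSeg∣ n s s≤n) ⟩
    ∣ S ∣                      ≡⟨ ∣p∣≡∣p∩q∣+∣p∩∁q∣ S I ⟩
    ∣ S ∩ I ∣ + ∣ S ∩ ∁ I ∣    ≤⟨ +-monoˡ-≤ _ (∣p∩q∣≤∣q∣ S I) ⟩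
    ∣ I ∣ + ∣ S ∩ ∁ I ∣        ∎)
    where open ≤-Reasoning

  independent⇒⊆basis : ∀ {I} → Independent I → ∃[ B ] (T (isBasis r s B) × I ⊆ B)
  independent⇒⊆basis {I} (∣I∣≤r , ∣I∩∁S∣≤1) with ∃⊆-of-size (S ∩ ∁ I) (r∸∣I∣≤∣S∩∁I∣ I)
  ... | Z , Z⊆S∩∁I , ∣Z∣≡r∸∣I∣ =
    I ∪ Z , Equivalence.from (T-isBasis⇔ (I ∪ Z)) (∣I∪Z∣≡r , ∣[I∪Z]∩∁S∣≤1) , p⊆p∪q Z
    where
    ∣I∪Z∣≡r : ∣ I ∪ Z ∣ ≡ r
    ∣I∪Z∣≡r = begin
      ∣ I ∪ Z ∣          ≡⟨ ∣p∪q∣≡∣p∣+∣q∣ I Z disjoint ⟩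
      ∣ I ∣ + ∣ Z ∣      ≡⟨ cong (∣ I ∣ +_) ∣Z∣≡r∸∣I∣ ⟩
      ∣ I ∣ + (r ∸ ∣ I ∣) ≡⟨ m+[n∸m]≡n ∣I∣≤r ⟩
      r                  ∎
      where
      open ≡-Reasoning
      disjoint : Empty (I ∩ Z)
      disjoint (y , y∈) = let (y∈I , y∈Z) = x∈p∩q⁻ I Z y∈ in
        x∈p⇒x∉∁p y∈I (proj₂ (x∈p∩q⁻ S (∁ I) (Z⊆S∩∁I y∈Z)))
    ∣[I∪Z]∩∁S∣≤1 : ∣ (I ∪ Z) ∩ ∁ S ∣ ≤ 1
    ∣[I∪Z]∩∁S∣≤1 = ≤-trans
      (p⊆q⇒∣p∣≤∣q∣ (q⊆r⇒[p∪q]∩∁r⊆p∩∁r {p = I} (proj₁ ∘ x∈p∩q⁻ S (∁ I) ∘ Z⊆S∩∁I))) ∣I∩∁S∣≤1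

  panRank≡rank : ∀ X → panRank r s X ≡ rank X
  panRank≡rank X with ∃-independent-⊆-of-rank X
  ... | I , I⊆X , independent , rank≤∣I∣ with independent⇒⊆basis independent
  ...   | B , basis , I⊆B = ≤-antisym
    (maxWhere-lub (isBasis r s) ∣X∩_∣ (allSubsets n) (λ _ → ∣X∩B∣≤rank X))
    (begin
      rank X         ≤⟨ rank≤∣I∣ ⟩
      ∣ I ∣          ≤⟨ p⊆q⇒∣p∣≤∣q∣ (λ y∈I → x∈p∩q⁺ (I⊆X y∈I , I⊆B y∈I)) ⟩
      ∣ X ∩ B ∣      ≤⟨ maxWhere-upper (isBasis r s) ∣X∩_∣ (allSubsets n) (∈-allSubsets B) basis ⟩
      panRank r s X  ∎)
    where
    open ≤-Reasoning
    ∣X∩_∣ : Subset n → ℕ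
    ∣X∩ B ∣ = ∣ X ∩ B ∣

  isFlat⇔closed : ∀ {F} → IsFlat r s F ⇔ Closed F
  isFlat⇔closed {F} = mk⇔
    (λ flat x x∉F → subst₂ _<_ (panRank≡rank F) (panRank≡rank (F ∪ ⁅ x ⁆))
                      (flat (F ∪ ⁅ x ⁆) (p⊂p∪⁅x⁆ x∉F)))
    (λ closed G (F⊆G , x , x∈G , x∉F) → subst₂ _<_ (sym (panRank≡rank F)) (sym (panRank≡rank G))
       (<-≤-trans (closed x x∉F) (rank-mono (p⊆q∧x∈q⇒p∪⁅x⁆⊆q F⊆G x∈G))))

proposition4p3 : (r s n : ℕ) → r ≤ s → s < n → (F : Subset n) →
    (IsFlat r s F × panRank r s F < r) ⇔
      ((F ⊆ initSeg n s × ∣ F ∣ + 1 ≤ r)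
       ⊎ (∃[ A ] (A ⊆ initSeg n s × ∣ A ∣ + 2 ≤ r × F ≡ ∁ (initSeg n s) ∪ A)))
proposition4p3 r s n r≤s s<n F =
  closed×rank<r⇔lowRankFlatShape ⇔-∘ (isFlat⇔closed ×-⇔ panRank<r⇔rank<r)
  where
  open TruncatedRank r (initSeg n s)
  open Panhandle r s n r≤s (<⇒≤ s<n)
  panRank<r⇔rank<r : panRank r s F < r ⇔ rank F < r
  panRank<r⇔rank<r = mk⇔ (subst (_< r) (panRank≡rank F)) (subst (_< r) (sym (panRank≡rank F)))
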